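{- Let $\Sigma$ and $\Omega$ be finite sets, let $\mathsf{At}$ be the set of nonempty subsets of $\Omega$, and consider the alphabet $\Sigma+\mathsf{At}$. Let $\mathcal{H}_2=\{\alpha\cdot\beta\le\alpha\cup\beta\mid\alpha,\beta\in\mathsf{At}\}$ and $\mathcal{H}_4=\{\alpha\le 1\mid\alpha\in\mathsf{At}\}$, where $\alpha\cup\beta$ denotes the single letter in $\mathsf{At}$. Then $\mathcal{H}_2\cup\mathcal{H}_4$ reduces to $\mathcal{H}_4$, witnessed by the homomorphism $r$ of regular expressions over $\Sigma+\mathsf{At}$ defined by $r(a)=a$ for $a\in\Sigma$ and $r(\alpha)=\sum\{\alpha_1\cdot\ldots\cdot\alpha_n\mid \alpha=\bigcup_{i\le n}\alpha_i,\ \alpha_i\in\mathsf{At},\ i\neq j\Rightarrow\alpha_i\neq\alpha_j\}$ for $\alpha\in\mathsf{At}$.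
   Context: Regular expressions $T(X)$ over an alphabet $X$: $e,f::=e+f\mid e\cdot f\mid e^*\mid 0\mid 1\mid a$ ($a\in X$), with usual language $\llbracket e\rrbracket$; a homomorphism is determined by its values on letters. Kleene algebra axioms: idempotent semiring axioms plus $1+xx^*\le x^*$, $x+yz\le z\Rightarrow y^*x\le z$, $x+yz\le y\Rightarrow xz^*\le y$. A hypothesis is a pair $e\le f$. $\mathsf{KA}_H\vdash e=f$ means derivable in equational logic from all instances of the Kleene algebra axioms and the hypotheses in $H$, letters being constants (no substitution rule); $\mathsf{KA}_H\vdash H'$ means all inequations of $H'$ are derivable. The $H$-closure $H^\star(L)$ is the smallest language containing $L$ such that for all $e\le f\in H$ and words $u,v$, $u\llbracket f\rrbracket v\subseteq H^\star(L)$ implies $u\llbracket e\rrbracket v\subseteq H^\star(L)$. Over a common alphabet $X$, $H$ reduces to $H'$ witnessed by $r:T(X)\to T(X)$ if $\mathsf{KA}_H\vdash H'$ and for all $e$, $\mathsf{KA}_H\vdash e=r(e)$ and $H^\star(\llbracket e\rrbracket)\subseteq H'^\star(\llbracket r(e)\rrbracket)$. -}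

module Defs where

open import Data.Nat using (ℕ; zero; suc)
open import Data.Fin using (Fin)
open import Data.Fin.Subset using (Subset; Nonempty; _∪_; inside; outside) renaming (⊥ to ∅)
open import Data.Fin.Subset.Properties using (nonempty?; p⊆p∪q)
open import Data.Bool using (Bool)
import Data.Bool.Properties as BoolP
open import Data.Vec using (Vec; []; _∷_)
import Data.Vec.Properties as VecP
open import Data.List using (List; []; _∷_; _++_; map; concatMap; foldr; filter)
open import Data.Product using (Σ; ∃; ∃-syntax; _×_; _,_; proj₁; proj₂)
open import Data.Sum using (_⊎_; inj₁; inj₂)
open import Relation.Nullary using (yes; no)
open import Relation.Binary.PropositionalEquality using (_≡_)

infixl 6 _+_
infixl 7 _·_

data RegExp (X : Set) : Set where
  _+_ : RegExp X → RegExp X → RegExp X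
  _·_ : RegExp X → RegExp X → RegExp X
  _⋆  : RegExp X → RegExp X
  𝟘   : RegExp X
  𝟙   : RegExp X
  var : X → RegExp X

hom : {X Y : Set} → (X → RegExp Y) → RegExp X → RegExp Y
hom σ (e + f) = hom σ e + hom σ f
hom σ (e · f) = hom σ e · hom σ f
hom σ (e ⋆)   = hom σ e ⋆
hom σ 𝟘       = 𝟘
hom σ 𝟙       = 𝟙
hom σ (var x) = σ x

Word : Set → Set
Word X = List X

Lang : Set → Set₁
Lang X = Word X → Set

data _∈⟦_⟧ {X : Set} : Word X → RegExp X → Set where
  ∈+ˡ  : ∀ {w e f} → w ∈⟦ e ⟧ → w ∈⟦ e + f ⟧
  ∈+ʳ  : ∀ {w e f} → w ∈⟦ f ⟧ → w ∈⟦ e + f ⟧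
  ∈·   : ∀ {u v e f} → u ∈⟦ e ⟧ → v ∈⟦ f ⟧ → (u ++ v) ∈⟦ e · f ⟧
  ∈⋆[] : ∀ {e} → [] ∈⟦ e ⋆ ⟧
  ∈⋆∷  : ∀ {u v e} → u ∈⟦ e ⟧ → v ∈⟦ e ⋆ ⟧ → (u ++ v) ∈⟦ e ⋆ ⟧
  ∈𝟙   : [] ∈⟦ 𝟙 ⟧
  ∈var : ∀ {a} → (a ∷ []) ∈⟦ var a ⟧

⟦_⟧ : {X : Set} → RegExp X → Lang X
⟦ e ⟧ w = w ∈⟦ e ⟧

Hyps : Set → Set₁
Hyps X = RegExp X → RegExp X → Set

_∪ₕ_ : {X : Set} → Hyps X → Hyps X → Hyps X
(H ∪ₕ H') e f = H e f ⊎ H' e f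

-- KA_H ⊢ e = f : equational logic from all instances of the KA axioms
-- and the hypotheses of H (letters are constants, no substitution rule).
-- e ≤ f abbreviates e + f = f.

infix 4 _⊢_≈_ _⊢_≤_

data _⊢_≈_ {X : Set} (H : Hyps X) : RegExp X → RegExp X → Set

_⊢_≤_ : {X : Set} → Hyps X → RegExp X → RegExp X → Set
H ⊢ e ≤ f = H ⊢ e + f ≈ f

data _⊢_≈_ {X} H where
  refl≈  : ∀ {e} → H ⊢ e ≈ e
  sym≈   : ∀ {e f} → H ⊢ e ≈ f → H ⊢ f ≈ e
  trans≈ : ∀ {e f g} → H ⊢ e ≈ f → H ⊢ f ≈ g → H ⊢ e ≈ g
  +-cong : ∀ {e e' f f'} → H ⊢ e ≈ e' → H ⊢ f ≈ f' → H ⊢ e + f ≈ e' + f'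
  ·-cong : ∀ {e e' f f'} → H ⊢ e ≈ e' → H ⊢ f ≈ f' → H ⊢ e · f ≈ e' · f'
  ⋆-cong : ∀ {e e'} → H ⊢ e ≈ e' → H ⊢ e ⋆ ≈ e' ⋆
  +-assoc : ∀ e f g → H ⊢ (e + f) + g ≈ e + (f + g)
  +-comm  : ∀ e f → H ⊢ e + f ≈ f + e
  +-idem  : ∀ e → H ⊢ e + e ≈ e
  +-zero  : ∀ e → H ⊢ e + 𝟘 ≈ e
  ·-assoc : ∀ e f g → H ⊢ (e · f) · g ≈ e · (f · g)
  ·-oneˡ  : ∀ e → H ⊢ 𝟙 · e ≈ e
  ·-oneʳ  : ∀ e → H ⊢ e · 𝟙 ≈ e
  ·-zeroˡ : ∀ e → H ⊢ 𝟘 · e ≈ 𝟘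
  ·-zeroʳ : ∀ e → H ⊢ e · 𝟘 ≈ 𝟘
  distribˡ : ∀ e f g → H ⊢ e · (f + g) ≈ e · f + e · g
  distribʳ : ∀ e f g → H ⊢ (e + f) · g ≈ e · g + f · g
  ⋆-unfold : ∀ e → H ⊢ 𝟙 + e · (e ⋆) ≤ e ⋆
  ⋆-indˡ   : ∀ {x y z} → H ⊢ x + y · z ≤ z → H ⊢ (y ⋆) · x ≤ z
  ⋆-indʳ   : ∀ {x y z} → H ⊢ x + y · z ≤ y → H ⊢ x · (z ⋆) ≤ y
  hyp : ∀ {e f} → H e f → H ⊢ e ≤ f

_⊢ₕ_ : {X : Set} → Hyps X → Hyps X → Set
H ⊢ₕ H' = ∀ e f → H' e f → H ⊢ e ≤ f

data Closure {X : Set} (H : Hyps X) (L : Lang X) : Lang X where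
  base : ∀ {w} → L w → Closure H L w
  step : ∀ {e f} (u v : Word X) → H e f →
         (∀ x → x ∈⟦ f ⟧ → Closure H L (u ++ x ++ v)) →
         ∀ {w} → w ∈⟦ e ⟧ → Closure H L (u ++ w ++ v)

_⊆ₗ_ : {X : Set} → Lang X → Lang X → Set
L ⊆ₗ K = ∀ w → L w → K w

Reduces : {X : Set} → Hyps X → Hyps X → (RegExp X → RegExp X) → Set
Reduces H H' r =
  (H ⊢ₕ H') ×
  (∀ e → H ⊢ e ≈ r e) ×
  (∀ e → Closure H ⟦ e ⟧ ⊆ₗ Closure H' ⟦ r e ⟧)

-- Atoms: nonempty subsets of Ω = Fin m (proof of nonemptiness irrelevant,
-- so atoms are equal iff their underlying subsets are equal)

record At (m : ℕ) : Set where
  constructor atom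
  field
    set : Subset m
    .nonempty : Nonempty set
open At public

nonempty-∪ : {m : ℕ} {p : Subset m} (q : Subset m) → Nonempty p → Nonempty (p ∪ q)
nonempty-∪ q (x , x∈p) = x , p⊆p∪q q x∈p

_∪ᵃ_ : {m : ℕ} → At m → At m → At m
atom p ne ∪ᵃ atom q _ = atom (p ∪ q) (nonempty-∪ q ne)

Alph : ℕ → ℕ → Set
Alph k m = Fin k ⊎ At m

atomE : {k m : ℕ} → At m → RegExp (Alph k m)
atomE α = var (inj₂ α)

H₂ : (k m : ℕ) → Hyps (Alph k m)
H₂ k m e f = Σ (At m) λ α → Σ (At m) λ β →
  (e ≡ atomE α · atomE β) × (f ≡ atomE (α ∪ᵃ β))

H₄ : (k m : ℕ) → Hyps (Alph k m)
H₄ k m e f = Σ (At m) λ α → (e ≡ atomE α) × (f ≡ 𝟙)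

allSubsets : (m : ℕ) → List (Subset m)
allSubsets zero    = [] ∷ []
allSubsets (suc m) = map (inside ∷_) (allSubsets m) ++ map (outside ∷_) (allSubsets m)

allAtoms : (m : ℕ) → List (At m)
allAtoms m = concatMap toAt (allSubsets m)
  where
  toAt : Subset m → List (At m)
  toAt p with nonempty? p
  ... | yes ne = atom p ne ∷ []
  ... | no _   = []

insertions : {A : Set} → A → List A → List (List A)
insertions x []       = (x ∷ []) ∷ []
insertions x (y ∷ ys) = (x ∷ y ∷ ys) ∷ map (y ∷_) (insertions x ys)

-- all sequences of pairwise-distinct-position elements of a list
-- (for a duplicate-free list: all lists of pairwise distinct elements)
arrangements : {A : Set} → List A → List (List A)
arrangements []       = [] ∷ []
arrangements (x ∷ xs) = arrangements xs ++ concatMap (insertions x) (arrangements xs)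

⋃ : {m : ℕ} → List (At m) → Subset m
⋃ = foldr (λ α p → set α ∪ p) ∅

_≟ˢ_ : {m : ℕ} (p q : Subset m) → Relation.Nullary.Dec (p ≡ q)
_≟ˢ_ = VecP.≡-dec BoolP._≟_

prodE : {X : Set} → List (RegExp X) → RegExp X
prodE []           = 𝟙
prodE (e ∷ [])     = e
prodE (e ∷ f ∷ es) = e · prodE (f ∷ es)

sumE : {X : Set} → List (RegExp X) → RegExp X
sumE []           = 𝟘
sumE (e ∷ [])     = e
sumE (e ∷ f ∷ es) = e + sumE (f ∷ es)

decompositions : {m : ℕ} → At m → List (List (At m))
decompositions {m} α = filter (λ l → ⋃ l ≟ˢ set α) (arrangements (allAtoms m))

rLetter : (k m : ℕ) → Alph k m → RegExp (Alph k m)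
rLetter k m (inj₁ a) = var (inj₁ a)
rLetter k m (inj₂ α) = sumE (map (λ l → prodE (map atomE l)) (decompositions α))

r : (k m : ℕ) → RegExp (Alph k m) → RegExp (Alph k m)
r k m = hom (rLetter k m)

-- Every product α₁ ⋯ αₙ of atoms is below the single atom α₁ ∪ ⋯ ∪ αₙ by H₂, and α is one
-- of the summands of r(α), so KA with H₂ ∪ H₄ proves e = r e.  For the closures, the
-- H₄-closure of a language L contains every word obtained from a word of L by inserting
-- atom letters.  This upward closure of ⟦ r e ⟧ is stable under the inverse of the
-- H₂-rewrite α ∪ β ↦ α β: an occurrence of α ∪ β in a word of ⟦ r e ⟧ sits inside a
-- product of pairwise distinct atoms with union δ, and replacing it by α β and then
-- deleting repeated atoms gives another such product, hence another word of ⟦ r e ⟧,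
-- which is a subword of the rewritten word up to inserted atoms.
module Submission where

open import Defs
open import Data.Nat using (ℕ)
open import Data.Empty using (⊥-elim)
open import Data.Fin.Subset using (Subset; Nonempty; inside; outside; _∪_; _⊆_) renaming (_∈_ to _∈ˢ_; ⊥ to ∅)
open import Data.Fin.Subset.Properties using (nonempty?; ∉⊥; x∈p∪q⁻; x∈p∪q⁺; ⊆-antisym; ∪-assoc; ∪-identityʳ)
open import Data.List using (List; []; _∷_; [_]; _++_; map; concatMap; deduplicate)
open import Data.List.Properties using (map-++; ∷-injective; ++-assoc)
open import Data.List.Membership.Propositional using (_∈_)
open import Data.List.Membership.Propositional.Properties using (∈-map⁺; ∈-map⁻; ∈-++⁺ˡ; ∈-++⁺ʳ; ∈-∃++; ∈-filter⁺; ∈-filter⁻; ∈-concatMap⁺; ∈-deduplicate⁺; ∈-deduplicate⁻)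
open import Data.List.Relation.Unary.Any using (here; there)
import Data.List.Relation.Unary.Any as Any
import Data.List.Relation.Unary.All as All
open import Data.List.Relation.Unary.All using ([])
open import Data.List.Relation.Unary.AllPairs using ([]; _∷_)
open import Data.List.Relation.Unary.Unique.Propositional using (Unique)
open import Data.List.Relation.Unary.Unique.DecPropositional.Properties using (deduplicate-!)
open import Data.List.Relation.Binary.Sublist.Propositional using ([]; _∷_; _∷ʳ_; ⊆-trans) renaming (_⊆_ to _⊆ˡ_)
open import Data.List.Relation.Binary.Sublist.Propositional.Properties using (filter-⊆)
import Data.List.Relation.Binary.Permutation.Setoid.Properties as Perm
import Data.Vec as Vec
open import Data.Product using (∃-syntax; Σ-syntax; _×_; _,_; proj₂)
open import Data.Sum using (_⊎_; inj₁; inj₂)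
open import Function.Base using (_∘_; _∋_)
open import Relation.Nullary using (yes; no)
open import Relation.Nullary.Decidable using (recompute)
open import Relation.Binary.Bundles using (Setoid)
open import Relation.Binary.Definitions using (DecidableEquality)
open import Relation.Binary.PropositionalEquality using (_≡_; _≢_; refl; sym; trans; cong; subst; setoid)
import Relation.Binary.Reasoning.Setoid as SetoidReasoning

module _ {X : Set} {H : Hyps X} where

  ⊢-setoid : Setoid _ _
  ⊢-setoid = record
    { Carrier = RegExp X
    ; _≈_ = H ⊢_≈_
    ; isEquivalence = record { refl = refl≈ ; sym = sym≈ ; trans = trans≈ }
    }

  open SetoidReasoning ⊢-setoid

  ≤-refl : ∀ e → H ⊢ e ≤ e
  ≤-refl = +-idem

  ≤-trans : ∀ {e f g} → H ⊢ e ≤ f → H ⊢ f ≤ g → H ⊢ e ≤ g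
  ≤-trans {e} {f} {g} e≤f f≤g = begin
    e + g        ≈⟨ +-cong refl≈ (sym≈ f≤g) ⟩
    e + (f + g)  ≈⟨ sym≈ (+-assoc e f g) ⟩
    (e + f) + g  ≈⟨ +-cong e≤f refl≈ ⟩
    f + g        ≈⟨ f≤g ⟩
    g            ∎

  ≤-antisym : ∀ {e f} → H ⊢ e ≤ f → H ⊢ f ≤ e → H ⊢ e ≈ f
  ≤-antisym {e} {f} e≤f f≤e = begin
    e      ≈⟨ sym≈ f≤e ⟩
    f + e  ≈⟨ +-comm f e ⟩
    e + f  ≈⟨ e≤f ⟩
    f      ∎

  𝟘≤ : ∀ e → H ⊢ 𝟘 ≤ e
  𝟘≤ e = trans≈ (+-comm 𝟘 e) (+-zero e)

  e≤e+f : ∀ e f → H ⊢ e ≤ e + f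
  e≤e+f e f = trans≈ (sym≈ (+-assoc e e f)) (+-cong (+-idem e) refl≈)

  f≤e+f : ∀ e f → H ⊢ f ≤ e + f
  f≤e+f e f = ≤-trans (e≤e+f f e) (trans≈ (+-cong (+-comm f e) refl≈) (+-idem (e + f)))

  +-lub : ∀ {e f g} → H ⊢ e ≤ g → H ⊢ f ≤ g → H ⊢ e + f ≤ g
  +-lub {e} {f} {g} e≤g f≤g = begin
    (e + f) + g  ≈⟨ +-assoc e f g ⟩
    e + (f + g)  ≈⟨ +-cong refl≈ f≤g ⟩
    e + g        ≈⟨ e≤g ⟩
    g            ∎

  ·-monoʳ-≤ : ∀ g {e f} → H ⊢ e ≤ f → H ⊢ g · e ≤ g · f
  ·-monoʳ-≤ g {e} {f} e≤f = trans≈ (sym≈ (distribˡ g e f)) (·-cong refl≈ e≤f)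

  sumE-least : ∀ es {g} → (∀ {e} → e ∈ es → H ⊢ e ≤ g) → H ⊢ sumE es ≤ g
  sumE-least []           bound = 𝟘≤ _
  sumE-least (e ∷ [])     bound = bound (here refl)
  sumE-least (e ∷ f ∷ es) bound = +-lub (bound (here refl)) (sumE-least (f ∷ es) (bound ∘ there))

  ∈⇒≤sumE : ∀ es {e} → e ∈ es → H ⊢ e ≤ sumE es
  ∈⇒≤sumE (e ∷ [])     (here refl) = ≤-refl e
  ∈⇒≤sumE (e ∷ f ∷ es) (here refl) = e≤e+f e (sumE (f ∷ es))
  ∈⇒≤sumE (e ∷ f ∷ es) (there e∈) = ≤-trans (∈⇒≤sumE (f ∷ es) e∈) (f≤e+f e (sumE (f ∷ es)))

module _ {X : Set} where

  ∈sumE⁻ : ∀ es {w} → w ∈⟦ sumE {X} es ⟧ → ∃[ e ] e ∈ es × w ∈⟦ e ⟧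
  ∈sumE⁻ (e ∷ [])     w∈e       = e , here refl , w∈e
  ∈sumE⁻ (e ∷ f ∷ es) (∈+ˡ w∈e) = e , here refl , w∈e
  ∈sumE⁻ (e ∷ f ∷ es) (∈+ʳ w∈s) with g , g∈ , w∈g ← ∈sumE⁻ (f ∷ es) w∈s = g , there g∈ , w∈g

  ∈sumE⁺ : ∀ es {e w} → e ∈ es → w ∈⟦ e ⟧ → w ∈⟦ sumE {X} es ⟧
  ∈sumE⁺ (e ∷ [])     (here refl) w∈e = w∈e
  ∈sumE⁺ (e ∷ f ∷ es) (here refl) w∈e = ∈+ˡ w∈e
  ∈sumE⁺ (e ∷ f ∷ es) (there e∈)  w∈e = ∈+ʳ (∈sumE⁺ (f ∷ es) e∈ w∈e)

  module _ {A : Set} (f : A → X) where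

    ∈prodE-letters⁻ : ∀ xs {w} → w ∈⟦ prodE (map (var ∘ f) xs) ⟧ → w ≡ map f xs
    ∈prodE-letters⁻ []           ∈𝟙            = refl
    ∈prodE-letters⁻ (x ∷ [])     ∈var          = refl
    ∈prodE-letters⁻ (x ∷ y ∷ xs) (∈· ∈var w∈p) = cong (f x ∷_) (∈prodE-letters⁻ (y ∷ xs) w∈p)

    ∈prodE-letters⁺ : ∀ xs → map f xs ∈⟦ prodE (map (var ∘ f) xs) ⟧
    ∈prodE-letters⁺ []           = ∈𝟙
    ∈prodE-letters⁺ (x ∷ [])     = ∈var
    ∈prodE-letters⁺ (x ∷ y ∷ xs) = ∈· ∈var (∈prodE-letters⁺ (y ∷ xs))

module _ {A : Set} where

  []≢++∷ : ∀ (u : List A) {c v} → [] ≢ u ++ c ∷ v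
  []≢++∷ []      ()
  []≢++∷ (_ ∷ _) ()

  ++-∷-split : ∀ (a b u : List A) c v → a ++ b ≡ u ++ c ∷ v →
    (∃[ t ] a ≡ u ++ c ∷ t × v ≡ t ++ b) ⊎ (∃[ t ] b ≡ t ++ c ∷ v × u ≡ a ++ t)
  ++-∷-split []      b u       c v eq = inj₂ (u , eq , refl)
  ++-∷-split (x ∷ a) b []      c v eq with refl , a++b≡v ← ∷-injective eq = inj₁ (a , refl , sym a++b≡v)
  ++-∷-split (x ∷ a) b (y ∷ u) c v eq with refl , eq′ ← ∷-injective eq with ++-∷-split a b u c v eq′
  ... | inj₁ (t , refl , v≡t++b) = inj₁ (t , refl , v≡t++b)
  ... | inj₂ (t , b≡t++cv , refl) = inj₂ (t , b≡t++cv , refl)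

  ∈-insertions : ∀ x (l₁ l₂ : List A) → l₁ ++ x ∷ l₂ ∈ insertions x (l₁ ++ l₂)
  ∈-insertions x []       []      = here refl
  ∈-insertions x []       (_ ∷ _) = here refl
  ∈-insertions x (y ∷ l₁) l₂      = there (∈-map⁺ (y ∷_) (∈-insertions x l₁ l₂))

  ∈-tail : ∀ {x y} {xs : List A} → y ∈ x ∷ xs → y ≢ x → y ∈ xs
  ∈-tail (here y≡x) y≢x = ⊥-elim (y≢x y≡x)
  ∈-tail (there y∈) _   = y∈

  module _ (_≟_ : DecidableEquality A) where
    open import Data.List.Membership.DecPropositional _≟_ using (_∈?_)
    open Perm (setoid A) using (shift; ∈-resp-↭; Unique-resp-↭)
    open import Data.List.Relation.Binary.Permutation.Setoid (setoid A) using (↭-sym)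

    arrangements-complete : ∀ xs {l : List A} → Unique l → (∀ {y} → y ∈ l → y ∈ xs) →
                            l ∈ arrangements xs
    arrangements-complete [] {[]}    _ _   = here refl
    arrangements-complete [] {_ ∷ _} _ l⊆ with () ← l⊆ (here refl)
    arrangements-complete (x ∷ xs) {l} !l l⊆ with x ∈? l
    ... | no x∉l = ∈-++⁺ˡ (arrangements-complete xs !l (λ y∈l → ∈-tail (l⊆ y∈l) λ { refl → x∉l y∈l }))
    ... | yes x∈l with l₁ , l₂ , refl ← ∈-∃++ x∈l
                  with x≢ ∷ !l′ ← Unique-resp-↭ (shift refl l₁ l₂) !l =
      ∈-++⁺ʳ (arrangements xs)
        (∈-concatMap⁺ (insertions x) (Any.map (λ { refl → ∈-insertions x l₁ l₂ }) l′∈))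
      where
      l′⊆xs : ∀ {y} → y ∈ l₁ ++ l₂ → y ∈ xs
      l′⊆xs y∈ = ∈-tail (l⊆ (∈-resp-↭ (↭-sym (shift refl l₁ l₂)) (there y∈)))
                        (λ { refl → All.lookup x≢ y∈ refl })
      l′∈ : l₁ ++ l₂ ∈ arrangements xs
      l′∈ = arrangements-complete xs !l′ l′⊆xs

  deduplicate-⊆ : (_≟_ : DecidableEquality A) → ∀ xs → deduplicate _≟_ xs ⊆ˡ xs
  deduplicate-⊆ _≟_ []       = []
  deduplicate-⊆ _≟_ (x ∷ xs) = refl ∷ ⊆-trans (filter-⊆ _ _) (deduplicate-⊆ _≟_ xs)

∈allSubsets : ∀ {m} (p : Subset m) → p ∈ allSubsets m
∈allSubsets Vec.[]            = here refl
∈allSubsets (inside Vec.∷ p)  = ∈-++⁺ˡ (∈-map⁺ _ (∈allSubsets p))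
∈allSubsets (outside Vec.∷ p) = ∈-++⁺ʳ _ (∈-map⁺ _ (∈allSubsets p))

module _ {m : ℕ} where

  atom-ext : {α β : At m} → set α ≡ set β → α ≡ β
  atom-ext {atom p _} refl = refl

  _≟ᵃ_ : DecidableEquality (At m)
  α ≟ᵃ β with set α ≟ˢ set β
  ... | yes eq = yes (atom-ext eq)
  ... | no neq = no (neq ∘ cong set)

  set-nonempty : (α : At m) → Nonempty (set α)
  set-nonempty (atom p ne) = recompute (nonempty? p) ne

  ∅≢set : (α : At m) → ∅ ≢ set α
  ∅≢set α ∅≡α with i , i∈α ← set-nonempty α = ∉⊥ (subst (i ∈ˢ_) (sym ∅≡α) i∈α)

  ∈concatMap-allSubsets : {B : Set} (f : Subset m → List B) (p : Subset m) {y : B} →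
                          y ∈ f p → y ∈ concatMap f (allSubsets m)
  ∈concatMap-allSubsets f p y∈fp = ∈-concatMap⁺ f (Any.map (λ { refl → y∈fp }) (∈allSubsets p))

  -- The local function of allAtoms cannot be named; the ascription instantiates f to it,
  -- so that the `with` on nonempty? p also rewrites the type of the second scrutinee.
  ∈allAtoms : (α : At m) → α ∈ allAtoms m
  ∈allAtoms (atom p ne)
    with nonempty? p | (atom p ne ∈ _ → atom p ne ∈ allAtoms m) ∋ ∈concatMap-allSubsets _ p
  ... | yes _  | ∈atomsOf-p⇒∈allAtoms = ∈atomsOf-p⇒∈allAtoms (here refl)
  ... | no ¬ne | _                    = ⊥-elim (¬ne (recompute (nonempty? p) ne))

  ∈⋃⁻ : ∀ (l : List (At m)) {i} → i ∈ˢ ⋃ l → ∃[ α ] α ∈ l × i ∈ˢ set α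
  ∈⋃⁻ []      i∈ = ⊥-elim (∉⊥ i∈)
  ∈⋃⁻ (α ∷ l) i∈ with x∈p∪q⁻ (set α) (⋃ l) i∈
  ... | inj₁ i∈α = α , here refl , i∈α
  ... | inj₂ i∈l with β , β∈l , i∈β ← ∈⋃⁻ l i∈l = β , there β∈l , i∈β

  ∈⋃⁺ : ∀ {l : List (At m)} {α i} → α ∈ l → i ∈ˢ set α → i ∈ˢ ⋃ l
  ∈⋃⁺ (here refl) i∈α = x∈p∪q⁺ (inj₁ i∈α)
  ∈⋃⁺ (there α∈l) i∈α = x∈p∪q⁺ (inj₂ (∈⋃⁺ α∈l i∈α))

  ⋃-mono : ∀ {l l′ : List (At m)} → (∀ {α} → α ∈ l → α ∈ l′) → ⋃ l ⊆ ⋃ l′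
  ⋃-mono l⊆l′ i∈ with α , α∈l , i∈α ← ∈⋃⁻ _ i∈ = ∈⋃⁺ (l⊆l′ α∈l) i∈α

  ⋃-deduplicate : ∀ l → ⋃ (deduplicate _≟ᵃ_ l) ≡ ⋃ l
  ⋃-deduplicate l = ⊆-antisym (⋃-mono (∈-deduplicate⁻ _≟ᵃ_ l)) (⋃-mono (∈-deduplicate⁺ _≟ᵃ_ {l}))

  ∈decompositions⁺ : ∀ (δ : At m) {l} → Unique l → ⋃ l ≡ set δ → l ∈ decompositions δ
  ∈decompositions⁺ δ !l ⋃l≡δ =
    ∈-filter⁺ (λ l → ⋃ l ≟ˢ set δ) (arrangements-complete _≟ᵃ_ (allAtoms m) !l (λ {α} _ → ∈allAtoms α)) ⋃l≡δ

  ∈decompositions⁻ : ∀ (δ : At m) {l} → l ∈ decompositions δ → ⋃ l ≡ set δ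
  ∈decompositions⁻ δ l∈ with _ , ⋃l≡δ ← ∈-filter⁻ (λ l → ⋃ l ≟ˢ set δ) {xs = arrangements (allAtoms m)} l∈ = ⋃l≡δ

  [δ]∈decompositions : (δ : At m) → [ δ ] ∈ decompositions δ
  [δ]∈decompositions δ = ∈decompositions⁺ δ {[ δ ]} ([] ∷ []) (∪-identityʳ (set δ))

  ⋃ᵃ : At m → List (At m) → At m
  ⋃ᵃ α []      = α
  ⋃ᵃ α (β ∷ l) = α ∪ᵃ ⋃ᵃ β l

  set-⋃ᵃ : ∀ α l → set (⋃ᵃ α l) ≡ ⋃ (α ∷ l)
  set-⋃ᵃ α []      = sym (∪-identityʳ (set α))
  set-⋃ᵃ α (β ∷ l) = cong (set α ∪_) (set-⋃ᵃ β l)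

module _ {k m : ℕ} where

  private
    H₂₄ : Hyps (Alph k m)
    H₂₄ = H₂ k m ∪ₕ H₄ k m

  ∈rAtom⁻ : ∀ (δ : At m) {w} → w ∈⟦ rLetter k m (inj₂ δ) ⟧ → ∃[ l ] l ∈ decompositions δ × w ≡ map inj₂ l
  ∈rAtom⁻ δ w∈ with e , e∈ , w∈e ← ∈sumE⁻ _ w∈ with l , l∈ , refl ← ∈-map⁻ (prodE ∘ map atomE) e∈ =
    l , l∈ , ∈prodE-letters⁻ inj₂ l w∈e

  ∈rAtom⁺ : ∀ (δ : At m) {l} → l ∈ decompositions δ → map inj₂ l ∈⟦ rLetter k m (inj₂ δ) ⟧
  ∈rAtom⁺ δ {l} l∈ = ∈sumE⁺ _ (∈-map⁺ _ l∈) (∈prodE-letters⁺ inj₂ l)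

  prodE≤⋃ᵃ : ∀ α l → H₂₄ ⊢ prodE (map atomE (α ∷ l)) ≤ atomE (⋃ᵃ α l)
  prodE≤⋃ᵃ α []      = ≤-refl _
  prodE≤⋃ᵃ α (β ∷ l) = ≤-trans (·-monoʳ-≤ (atomE α) (prodE≤⋃ᵃ β l)) (hyp (inj₁ (α , ⋃ᵃ β l , refl , refl)))

  prodE≤atom : ∀ (δ : At m) l → ⋃ l ≡ set δ → H₂₄ ⊢ prodE (map atomE l) ≤ atomE δ
  prodE≤atom δ []      ∅≡δ = ⊥-elim (∅≢set δ ∅≡δ)
  prodE≤atom δ (α ∷ l) ⋃≡δ with refl ← atom-ext {α = ⋃ᵃ α l} {δ} (trans (set-⋃ᵃ α l) ⋃≡δ) = prodE≤⋃ᵃ α l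

  atom≈rAtom : ∀ (δ : At m) → H₂₄ ⊢ atomE δ ≈ rLetter k m (inj₂ δ)
  atom≈rAtom δ = ≤-antisym
    (∈⇒≤sumE _ (∈-map⁺ _ ([δ]∈decompositions δ)))
    (sumE-least _ summand≤δ)
    where
    summand≤δ : ∀ {e} → e ∈ map (prodE ∘ map atomE) (decompositions δ) → H₂₄ ⊢ e ≤ atomE δ
    summand≤δ e∈ with l , l∈ , refl ← ∈-map⁻ (prodE ∘ map atomE) e∈ = prodE≤atom δ l (∈decompositions⁻ δ l∈)

  ≈r : ∀ e → H₂₄ ⊢ e ≈ r k m e
  ≈r (e + f)          = +-cong (≈r e) (≈r f)
  ≈r (e · f)          = ·-cong (≈r e) (≈r f)
  ≈r (e ⋆)            = ⋆-cong (≈r e)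
  ≈r 𝟘                = refl≈
  ≈r 𝟙                = refl≈
  ≈r (var (inj₁ a))   = refl≈
  ≈r (var (inj₂ δ))   = atom≈rAtom δ

module _ {k m : ℕ} where

  infix 4 _⊑_

  data _⊑_ : Word (Alph k m) → Word (Alph k m) → Set where
    []   : [] ⊑ []
    keep : ∀ x {xs ys} → xs ⊑ ys → x ∷ xs ⊑ x ∷ ys
    skip : ∀ α {xs ys} → xs ⊑ ys → xs ⊑ inj₂ α ∷ ys

  ⊑-refl : ∀ xs → xs ⊑ xs
  ⊑-refl []       = []
  ⊑-refl (x ∷ xs) = keep x (⊑-refl xs)

  ⊑-trans : ∀ {xs ys zs} → xs ⊑ ys → ys ⊑ zs → xs ⊑ zs
  ⊑-trans p          []         = p
  ⊑-trans p          (skip α q) = skip α (⊑-trans p q)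
  ⊑-trans (keep x p) (keep x q) = keep x (⊑-trans p q)
  ⊑-trans (skip α p) (keep _ q) = skip α (⊑-trans p q)

  ⊑-++ : ∀ {as bs cs ds} → as ⊑ bs → cs ⊑ ds → as ++ cs ⊑ bs ++ ds
  ⊑-++ []         q = q
  ⊑-++ (keep x p) q = keep x (⊑-++ p q)
  ⊑-++ (skip α p) q = skip α (⊑-++ p q)

  ⊑-insert : ∀ u {s v} α → s ⊑ u ++ v → s ⊑ u ++ inj₂ α ∷ v
  ⊑-insert []      α p          = skip α p
  ⊑-insert (x ∷ u) α (keep x p) = keep x (⊑-insert u α p)
  ⊑-insert (x ∷ u) α (skip β p) = skip β (⊑-insert u α p)

  ⊑-split : ∀ u {z v} c → z ⊑ u ++ c ∷ v →
    (∃[ z₁ ] ∃[ z₂ ] z ≡ z₁ ++ c ∷ z₂ × z₁ ⊑ u × z₂ ⊑ v) ⊎ z ⊑ u ++ v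
  ⊑-split []      c (keep c p) = inj₁ ([] , _ , refl , [] , p)
  ⊑-split []      c (skip α p) = inj₂ p
  ⊑-split (x ∷ u) c (keep x p) with ⊑-split u c p
  ... | inj₁ (z₁ , z₂ , refl , p₁ , p₂) = inj₁ (x ∷ z₁ , z₂ , refl , keep x p₁ , p₂)
  ... | inj₂ p′                        = inj₂ (keep x p′)
  ⊑-split (x ∷ u) c (skip β p) with ⊑-split u c p
  ... | inj₁ (z₁ , z₂ , refl , p₁ , p₂) = inj₁ (z₁ , z₂ , refl , skip β p₁ , p₂)
  ... | inj₂ p′                        = inj₂ (skip β p′)

  ⊆⇒⊑ : ∀ {l l′ : List (At m)} → l ⊆ˡ l′ → map inj₂ l ⊑ map inj₂ l′
  ⊆⇒⊑ []          = []
  ⊆⇒⊑ (α ∷ʳ l⊆)   = skip α (⊆⇒⊑ l⊆)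
  ⊆⇒⊑ (refl ∷ l⊆) = keep _ (⊆⇒⊑ l⊆)

  infix 25 ↑_

  ↑_ : Lang (Alph k m) → Lang (Alph k m)
  (↑ L) w = ∃[ z ] L z × z ⊑ w

  ↑-map : ∀ {L K : Lang (Alph k m)} {w} → (∀ {z} → L z → K z) → (↑ L) w → (↑ K) w
  ↑-map L⊆K (z , z∈L , z⊑w) = z , L⊆K z∈L , z⊑w

  ↑-insert : ∀ {L} u {v} α → (↑ L) (u ++ v) → (↑ L) (u ++ inj₂ α ∷ v)
  ↑-insert u α (z , z∈L , z⊑uv) = z , z∈L , ⊑-insert u α z⊑uv

  ↑⊆H₄-closure : ∀ {L} → ↑ L ⊆ₗ Closure (H₄ k m) L
  ↑⊆H₄-closure {L} _ (z , z∈L , z⊑w) = ⊑-closure [] (base z∈L) z⊑w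
    where
    ⊑-closure : ∀ p {s s′} → Closure (H₄ k m) L (p ++ s) → s ⊑ s′ → Closure (H₄ k m) L (p ++ s′)
    ⊑-closure p c [] = c
    ⊑-closure p {x ∷ xs} {x ∷ ys} c (keep x q) =
      subst (Closure _ L) (++-assoc p [ x ] ys)
        (⊑-closure (p ++ [ x ]) (subst (Closure _ L) (sym (++-assoc p [ x ] xs)) c) q)
    ⊑-closure p {_} {_ ∷ ys} c (skip α q) =
      step p ys (α , refl , refl) (λ { _ ∈𝟙 → ⊑-closure p c q }) ∈var

  module _ (α β : At m) where

    private
      γ : At m
      γ = α ∪ᵃ β

    SplitsAt : Lang (Alph k m) → Word (Alph k m) → Set
    SplitsAt L w = ∀ u v → w ≡ u ++ inj₂ γ ∷ v → (↑ L) (u ++ inj₂ α ∷ inj₂ β ∷ v)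

    split-++ : ∀ {A B C : Lang (Alph k m)} {a b} → (∀ {x y} → A x → B y → C (x ++ y)) →
               A a → B b → SplitsAt A a → SplitsAt B b → SplitsAt C (a ++ b)
    split-++ {a = a} {b} _∙_ a∈A b∈B split-a split-b u v eq with ++-∷-split a b u _ v eq
    ... | inj₁ (t , refl , refl) with z , z∈A , z⊑ ← split-a u t refl =
      z ++ b , z∈A ∙ b∈B , subst (z ++ b ⊑_) (++-assoc u _ b) (⊑-++ z⊑ (⊑-refl b))
    ... | inj₂ (t , refl , refl) with z , z∈B , z⊑ ← split-b t v refl =
      a ++ z , a∈A ∙ z∈B , subst (a ++ z ⊑_) (sym (++-assoc a t _)) (⊑-++ (⊑-refl a) z⊑)

    ⋃-∪ᵃ : ∀ l₁ l₂ → ⋃ (l₁ ++ α ∷ β ∷ l₂) ≡ ⋃ (l₁ ++ γ ∷ l₂)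
    ⋃-∪ᵃ []       l₂ = sym (∪-assoc (set α) (set β) (⋃ l₂))
    ⋃-∪ᵃ (δ ∷ l₁) l₂ = cong (set δ ∪_) (⋃-∪ᵃ l₁ l₂)

    map-inj₂-split : ∀ (l : List (At m)) (u v : Word (Alph k m)) → map inj₂ l ≡ u ++ inj₂ γ ∷ v →
      Σ[ l₁ ∈ List (At m) ] Σ[ l₂ ∈ List (At m) ] l ≡ l₁ ++ γ ∷ l₂ × u ≡ map inj₂ l₁ × v ≡ map inj₂ l₂
    map-inj₂-split []      u       v eq   = ⊥-elim ([]≢++∷ u eq)
    map-inj₂-split (δ ∷ l) []      v refl = [] , l , refl , refl , refl
    map-inj₂-split (δ ∷ l) (x ∷ u) v eq with ∷-injective eq
    ... | refl , eq′ with map-inj₂-split l u v eq′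
    ... | l₁ , l₂ , refl , refl , refl = δ ∷ l₁ , l₂ , refl , refl , refl

    rAtom-splits : ∀ (δ : At m) {w} → w ∈⟦ rLetter k m (inj₂ δ) ⟧ → SplitsAt ⟦ rLetter k m (inj₂ δ) ⟧ w
    rAtom-splits δ w∈ u v eq with l , l∈ , refl ← ∈rAtom⁻ δ w∈
                             with l₁ , l₂ , refl , refl , refl ← map-inj₂-split l u v eq =
      map inj₂ d , ∈rAtom⁺ δ (∈decompositions⁺ δ (deduplicate-! _≟ᵃ_ l′) ⋃d≡δ) ,
      subst (map inj₂ d ⊑_) (map-++ inj₂ l₁ (α ∷ β ∷ l₂)) (⊆⇒⊑ (deduplicate-⊆ _≟ᵃ_ l′))
      where
      l′ = l₁ ++ α ∷ β ∷ l₂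
      d = deduplicate _≟ᵃ_ l′
      ⋃d≡δ : ⋃ d ≡ set δ
      ⋃d≡δ = trans (⋃-deduplicate l′) (trans (⋃-∪ᵃ l₁ l₂) (∈decompositions⁻ δ l∈))

    r-splits : ∀ e {w} → w ∈⟦ r k m e ⟧ → SplitsAt ⟦ r k m e ⟧ w
    r-splits (e + f)        (∈+ˡ w∈) u v eq = ↑-map ∈+ˡ (r-splits e w∈ u v eq)
    r-splits (e + f)        (∈+ʳ w∈) u v eq = ↑-map ∈+ʳ (r-splits f w∈ u v eq)
    r-splits (e · f)        (∈· a∈ b∈)      = split-++ ∈· a∈ b∈ (r-splits e a∈) (r-splits f b∈)
    r-splits (e ⋆)          ∈⋆[]     u v eq = ⊥-elim ([]≢++∷ u eq)
    r-splits (e ⋆)          (∈⋆∷ a∈ b∈)     = split-++ ∈⋆∷ a∈ b∈ (r-splits e a∈) (r-splits (e ⋆) b∈)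
    r-splits 𝟙              ∈𝟙       u v eq = ⊥-elim ([]≢++∷ u eq)
    r-splits (var (inj₁ a)) ∈var     (x ∷ u) v eq = ⊥-elim ([]≢++∷ u (proj₂ (∷-injective eq)))
    r-splits (var (inj₂ δ)) w∈              = rAtom-splits δ w∈

    ↑-split : ∀ {L} → (∀ {w} → L w → SplitsAt L w) → ∀ u v → (↑ L) (u ++ inj₂ γ ∷ v) → (↑ L) (u ++ inj₂ α ∷ inj₂ β ∷ v)
    ↑-split splits u v (z , z∈L , z⊑) with ⊑-split u _ z⊑
    ... | inj₂ z⊑uv = z , z∈L , ⊑-insert u α (⊑-insert u β z⊑uv)
    ... | inj₁ (z₁ , z₂ , refl , z₁⊑u , z₂⊑v) with z′ , z′∈L , z′⊑ ← splits z∈L z₁ z₂ refl =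
      z′ , z′∈L , ⊑-trans z′⊑ (⊑-++ z₁⊑u (keep _ (keep _ z₂⊑v)))

  ∈⟦⟧⇒∈⟦r⟧ : ∀ {e w} → w ∈⟦ e ⟧ → w ∈⟦ r k m e ⟧
  ∈⟦⟧⇒∈⟦r⟧ (∈+ˡ w∈)    = ∈+ˡ (∈⟦⟧⇒∈⟦r⟧ w∈)
  ∈⟦⟧⇒∈⟦r⟧ (∈+ʳ w∈)    = ∈+ʳ (∈⟦⟧⇒∈⟦r⟧ w∈)
  ∈⟦⟧⇒∈⟦r⟧ (∈· a∈ b∈)  = ∈· (∈⟦⟧⇒∈⟦r⟧ a∈) (∈⟦⟧⇒∈⟦r⟧ b∈)
  ∈⟦⟧⇒∈⟦r⟧ ∈⋆[]        = ∈⋆[]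
  ∈⟦⟧⇒∈⟦r⟧ (∈⋆∷ a∈ b∈) = ∈⋆∷ (∈⟦⟧⇒∈⟦r⟧ a∈) (∈⟦⟧⇒∈⟦r⟧ b∈)
  ∈⟦⟧⇒∈⟦r⟧ ∈𝟙          = ∈𝟙
  ∈⟦⟧⇒∈⟦r⟧ {var (inj₁ a)} ∈var = ∈var
  ∈⟦⟧⇒∈⟦r⟧ {var (inj₂ δ)} ∈var = ∈rAtom⁺ δ ([δ]∈decompositions δ)

  H₂₄-closure⊆↑⟦r⟧ : ∀ e → Closure (H₂ k m ∪ₕ H₄ k m) ⟦ e ⟧ ⊆ₗ ↑ ⟦ r k m e ⟧
  H₂₄-closure⊆↑⟦r⟧ e _ (base w∈) = _ , ∈⟦⟧⇒∈⟦r⟧ w∈ , ⊑-refl _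
  H₂₄-closure⊆↑⟦r⟧ e _ (step u v (inj₂ (α , refl , refl)) closed ∈var) =
    ↑-insert u α (H₂₄-closure⊆↑⟦r⟧ e _ (closed [] ∈𝟙))
  H₂₄-closure⊆↑⟦r⟧ e _ (step u v (inj₁ (α , β , refl , refl)) closed (∈· ∈var ∈var)) =
    ↑-split α β (r-splits α β e) u v (H₂₄-closure⊆↑⟦r⟧ e _ (closed _ ∈var))

lemma9p2 : (k m : ℕ) → Reduces (H₂ k m ∪ₕ H₄ k m) (H₄ k m) (r k m)
lemma9p2 k m =
  (λ _ _ h → hyp (inj₂ h)) ,
  ≈r ,
  (λ e w w∈ → ↑⊆H₄-closure w (H₂₄-closure⊆↑⟦r⟧ e w w∈))
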